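{- Let $m \ge 3$ be odd, and let $t$ be a positive integer with $t \mid 6m$ and $\gcd(6,t)=6$. Then $K_{6[m]}^*$ admits a $\vec{C}_t$-factorization.
   Context: $K_{n[m]}^*$ denotes the complete symmetric equipartite digraph with $n$ parts of size $m$: vertex set partitioned into $n$ parts of size $m$, with $(u,v)$ an arc if and only if $u,v$ lie in different parts. $\vec{C}_t$ is the directed cycle of length $t$. A $\vec{C}_t$-factor of a digraph $D$ is a spanning subdigraph that is a disjoint union of directed $t$-cycles; a $\vec{C}_t$-factorization of $D$ is a set of $\vec{C}_t$-factors whose arc sets partition $A(D)$. -}

module Defs where

open import Data.Nat using (ℕ; zero; suc; _<_)
open import Data.Fin using (Fin)
open import Data.Product using (Σ; _×_; _,_; proj₁; proj₂; ∃)
open import Relation.Binary.PropositionalEquality using (_≡_)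
open import Relation.Nullary using (¬_)
open import Function using (id; _∘_)
open import Function.Bundles using (_↔_)

record Digraph : Set₁ where
  field
    V   : Set
    Arc : V → V → Set

K* : ℕ → ℕ → Digraph
K* n m = record
  { V   = Fin n × Fin m
  ; Arc = λ u v → ¬ (proj₁ u ≡ proj₁ v) }

iter : {A : Set} → ℕ → (A → A) → A → A
iter zero    f = id
iter (suc k) f = f ∘ iter k f

record CtFactor (D : Digraph) (t : ℕ) : Set where
  open Digraph D
  field
    succ      : V → V
    bijective : Σ (V → V) λ pred → ((v : V) → pred (succ v) ≡ v) × ((v : V) → succ (pred v) ≡ v)
    arcs      : (v : V) → Arc v (succ v)
    closes    : (v : V) → iter t succ v ≡ v
    exact     : (v : V) (k : ℕ) → 0 < k → k < t → ¬ (iter k succ v ≡ v)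

InFactor : {D : Digraph} {t : ℕ} → CtFactor D t → Digraph.V D → Digraph.V D → Set
InFactor F u v = CtFactor.succ F u ≡ v

record CtFactorization (D : Digraph) (t : ℕ) : Set₁ where
  open Digraph D
  field
    size    : ℕ
    factor  : Fin size → CtFactor D t
    cover   : (u v : V) → Arc u v → Σ (Fin size) λ i → InFactor (factor i) u v
    unique  : (u v : V) → (i j : Fin size) →
              InFactor (factor i) u v → InFactor (factor j) u v → i ≡ j

-- Each factor is, up to a permutation of the parts, a voltage lift: the directed 6-cycle
-- 0 → 1 → ⋯ → 5 → 0 on the parts, with voltages in ℤ_m on its arcs, lifted to
-- (p , x) → (p + 1 , x + voltage).  If the voltages around the cycle add up to g = m / d, every
-- lifted cycle closes after exactly d turns, so the lift is a →C_{6d}-factor.  A pattern is a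
-- 6-cycle through part 0 with a sign +, − or 0 on each arc, as many + as −; for an amplitude A
-- the voltages are +A, −A, 0, plus g on the arc leaving part 0, so they sum to g modulo m.
-- Writing m = 2k + 3, every element of ℤ_m is uniquely 0, +A or −A with 1 ≤ A ≤ k + 1.  The 15
-- small patterns (amplitude 1, all three signs) and the 10 large patterns (each amplitude
-- 2, …, k + 1, signs ±) realize, for each sign, every ordered pair of distinct parts exactly
-- once — a finite check — so the 15 + 10 k = 5 m lifts cover every arc of K*_{6[m]} exactly once.

module Submission where

open import Defs
open import Data.Nat using (ℕ; zero; suc; _+_; _*_; _∸_; _≤_; _<_; _≥_; z≤n; s≤s; _≤?_; pred; z<s;
  NonZero; >-nonZero⁻¹; ≢-nonZero; ≢-nonZero⁻¹)
open import Data.Nat.Properties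
open import Data.Nat.DivMod using (_%_; _/_; _mod_; m≡m%n+[m/n]*n; [m+kn]%n≡m%n; [m+n]%n≡m%n;
  m<n⇒m%n≡m; m%n<n)
open import Data.Nat.Divisibility using (_∣_; divides; m%n≡0⇒n∣m; ∣⇒≤; *-cancelʳ-∣)
open import Data.Nat.GCD using (gcd; gcd[m,n]∣n)
open import Data.Fin using (Fin; zero; suc; toℕ; fromℕ<; #_)
open import Data.Fin.Properties using (toℕ-injective; toℕ-fromℕ<; toℕ<n; all?; any?; +↔⊎; *↔×)
  renaming (_≟_ to _≟ᶠ_)
open import Data.Vec using (Vec; []; _∷_; lookup; map; sum; count)
open import Data.Product using (Σ; _×_; _,_; proj₁; proj₂; map₁)
open import Data.Sum using (_⊎_; inj₁; inj₂)
open import Data.Sum.Function.Propositional using (_⊎-↔_)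
open import Data.Empty using (⊥-elim)
open import Function using (_∘_)
open import Function.Bundles using (_↔_; Inverse)
open import Function.Properties.Inverse using (↔-refl; ↔-trans)
open import Algebra.Properties.CommutativeSemigroup +-commutativeSemigroup using (x∙yz≈y∙xz; xy∙z≈xz∙y)
open import Relation.Nullary using (Dec; yes; no; ¬?)
open import Relation.Nullary.Decidable using (toWitness; map′; _×-dec_; _⊎-dec_; _→-dec_)
open import Relation.Binary.Definitions using (DecidableEquality)
open import Relation.Binary.PropositionalEquality
open ≡-Reasoning

iter-suc : ∀ {A : Set} (f : A → A) k x → iter (suc k) f x ≡ iter k f (f x)
iter-suc f zero    x = refl
iter-suc f (suc k) x = cong f (iter-suc f k x)

iter-conjugate : ∀ {A B : Set} (f : A → A) (Φ : B → A) (Ψ : A → B) → (∀ a → Φ (Ψ a) ≡ a) →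
  ∀ k a → iter k (Ψ ∘ f ∘ Φ) (Ψ a) ≡ Ψ (iter k f a)
iter-conjugate f Φ Ψ ΦΨ zero    a = refl
iter-conjugate f Φ Ψ ΦΨ (suc k) a =
  cong (Ψ ∘ f) (trans (cong Φ (iter-conjugate f Φ Ψ ΦΨ k a)) (ΦΨ (iter k f a)))

conjugate : ∀ {D : Digraph} {t} (let open Digraph D) (Φ Ψ : V → V) →
  (∀ v → Φ (Ψ v) ≡ v) → (∀ v → Ψ (Φ v) ≡ v) → (∀ {u v} → Arc u v → Arc (Ψ u) (Ψ v)) →
  CtFactor D t → CtFactor D t
conjugate {D} {t} Φ Ψ ΦΨ ΨΦ Ψ-arc F = record
  { succ      = succ′
  ; bijective = Ψ ∘ prev ∘ Φ
              , (λ v → trans (cong (Ψ ∘ prev) (ΦΨ _)) (trans (cong Ψ (prev-succ (Φ v))) (ΨΦ v)))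
              , (λ v → trans (cong (Ψ ∘ succ) (ΦΨ _)) (trans (cong Ψ (succ-prev (Φ v))) (ΨΦ v)))
  ; arcs      = λ v → subst (λ u → Digraph.Arc D u (succ′ v)) (ΨΦ v) (Ψ-arc (arcs (Φ v)))
  ; closes    = λ v → trans (iter-succ′ t v) (trans (cong Ψ (closes (Φ v))) (ΨΦ v))
  ; exact     = λ v k 0<k k<t e →
      exact (Φ v) k 0<k k<t (trans (sym (ΦΨ _)) (cong Φ (trans (sym (iter-succ′ k v)) e)))
  }
  where
    open CtFactor F
    V : Set
    V = Digraph.V D
    prev : V → V
    prev = proj₁ bijective
    prev-succ : ∀ v → prev (succ v) ≡ v
    prev-succ = proj₁ (proj₂ bijective)
    succ-prev : ∀ v → succ (prev v) ≡ v
    succ-prev = proj₂ (proj₂ bijective)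
    succ′ : V → V
    succ′ = Ψ ∘ succ ∘ Φ
    iter-succ′ : ∀ k v → iter k succ′ v ≡ Ψ (iter k succ (Φ v))
    iter-succ′ k v = trans (cong (iter k succ′) (sym (ΨΦ v))) (iter-conjugate succ Φ Ψ ΦΨ k (Φ v))

permuteParts : ∀ {n m t} (π π⁻¹ : Fin n → Fin n) → (∀ p → π⁻¹ (π p) ≡ p) → (∀ i → π (π⁻¹ i) ≡ i) →
  CtFactor (K* n m) t → CtFactor (K* n m) t
permuteParts π π⁻¹ π⁻¹∘π π∘π⁻¹ = conjugate (map₁ π⁻¹) (map₁ π)
  (λ (p , x) → cong (_, x) (π⁻¹∘π p)) (λ (i , x) → cong (_, x) (π∘π⁻¹ i))
  (λ p≢q πp≡πq → p≢q (trans (sym (π⁻¹∘π _)) (trans (cong π⁻¹ πp≡πq) (π⁻¹∘π _))))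

factorization-from-family : ∀ {D : Digraph} {t n} {I : Set} (let open Digraph D) →
  Fin n ↔ I → (F : I → CtFactor D t) →
  (∀ u v → Arc u v → Σ I λ e → InFactor (F e) u v) →
  (∀ e e′ u v → InFactor (F e) u v → InFactor (F e′) u v → e ≡ e′) →
  CtFactorization D t
factorization-from-family {n = n} I↔ F cover unique = record
  { size   = n
  ; factor = F ∘ to
  ; cover  = λ u v a → let (e , e∋uv) = cover u v a in
      from e , subst (λ e′ → InFactor (F e′) u v) (sym (strictlyInverseˡ e)) e∋uv
  ; unique = λ u v i j i∋uv j∋uv → begin
      i             ≡⟨ strictlyInverseʳ i ⟨
      from (to i)   ≡⟨ cong from (unique (to i) (to j) u v i∋uv j∋uv) ⟩
      from (to j)   ≡⟨ strictlyInverseʳ j ⟩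
      j             ∎
  }
  where open Inverse I↔

-- Arithmetic in ℤ_n

module _ {n : ℕ} .{{_ : NonZero n}} where

  %-absorbˡ : ∀ a b → (a % n + b) % n ≡ (a + b) % n
  %-absorbˡ a b = begin
    (a % n + b) % n                ≡⟨ [m+kn]%n≡m%n (a % n + b) (a / n) n ⟨
    (a % n + b + a / n * n) % n    ≡⟨ cong (_% n) (xy∙z≈xz∙y (a % n) b (a / n * n)) ⟩
    (a % n + a / n * n + b) % n    ≡⟨ cong (λ v → (v + b) % n) (m≡m%n+[m/n]*n a n) ⟨
    (a + b) % n                    ∎

  %-absorbʳ : ∀ a b → (a + b % n) % n ≡ (a + b) % n
  %-absorbʳ a b = begin
    (a + b % n) % n  ≡⟨ cong (_% n) (+-comm a (b % n)) ⟩
    (b % n + a) % n  ≡⟨ %-absorbˡ b a ⟩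
    (b + a) % n      ≡⟨ cong (_% n) (+-comm b a) ⟩
    (a + b) % n      ∎

  infixl 6 _⊕_ _⊖_

  _⊕_ : Fin n → ℕ → Fin n
  x ⊕ a = (toℕ x + a) mod n

  _⊖_ : Fin n → Fin n → ℕ
  y ⊖ x = (toℕ y + (n ∸ toℕ x)) % n

  toℕ-⊕ : ∀ x a → toℕ (x ⊕ a) ≡ (toℕ x + a) % n
  toℕ-⊕ x a = toℕ-fromℕ< (m%n<n (toℕ x + a) n)

  %-fin : ∀ (x : Fin n) → toℕ x % n ≡ toℕ x
  %-fin x = m<n⇒m%n≡m (toℕ<n x)

  ⊕-identityʳ : ∀ x → x ⊕ 0 ≡ x
  ⊕-identityʳ x = toℕ-injective (begin
    toℕ (x ⊕ 0)        ≡⟨ toℕ-⊕ x 0 ⟩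
    (toℕ x + 0) % n    ≡⟨ cong (_% n) (+-identityʳ (toℕ x)) ⟩
    toℕ x % n          ≡⟨ %-fin x ⟩
    toℕ x              ∎)

  ⊕-⊕ : ∀ x a b → x ⊕ a ⊕ b ≡ x ⊕ (a + b)
  ⊕-⊕ x a b = toℕ-injective (begin
    toℕ (x ⊕ a ⊕ b)               ≡⟨ toℕ-⊕ (x ⊕ a) b ⟩
    (toℕ (x ⊕ a) + b) % n         ≡⟨ cong (λ v → (v + b) % n) (toℕ-⊕ x a) ⟩
    ((toℕ x + a) % n + b) % n     ≡⟨ %-absorbˡ (toℕ x + a) b ⟩
    (toℕ x + a + b) % n           ≡⟨ cong (_% n) (+-assoc (toℕ x) a b) ⟩
    (toℕ x + (a + b)) % n         ≡⟨ toℕ-⊕ x (a + b) ⟨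
    toℕ (x ⊕ (a + b))             ∎)

  ⊕-multiple : ∀ x q → x ⊕ q * n ≡ x
  ⊕-multiple x q = toℕ-injective (begin
    toℕ (x ⊕ q * n)        ≡⟨ toℕ-⊕ x (q * n) ⟩
    (toℕ x + q * n) % n    ≡⟨ [m+kn]%n≡m%n (toℕ x) q n ⟩
    toℕ x % n              ≡⟨ %-fin x ⟩
    toℕ x                  ∎)

  ⊕-modulus : ∀ x → x ⊕ n ≡ x
  ⊕-modulus x = trans (cong (x ⊕_) (sym (*-identityˡ n))) (⊕-multiple x 1)

  ⊕-+-multiple : ∀ x a q → x ⊕ (a + q * n) ≡ x ⊕ a
  ⊕-+-multiple x a q = trans (sym (⊕-⊕ x a (q * n))) (⊕-multiple (x ⊕ a) q)

  ⊕-% : ∀ x a → x ⊕ a % n ≡ x ⊕ a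
  ⊕-% x a = toℕ-injective (begin
    toℕ (x ⊕ a % n)          ≡⟨ toℕ-⊕ x (a % n) ⟩
    (toℕ x + a % n) % n      ≡⟨ %-absorbʳ (toℕ x) a ⟩
    (toℕ x + a) % n          ≡⟨ toℕ-⊕ x a ⟨
    toℕ (x ⊕ a)              ∎)

  ⊖<n : ∀ y x → y ⊖ x < n
  ⊖<n y x = m%n<n (toℕ y + (n ∸ toℕ x)) n

  private
    x+[a+[n∸x]]≡a+n : ∀ (x : Fin n) a → toℕ x + (a + (n ∸ toℕ x)) ≡ a + n
    x+[a+[n∸x]]≡a+n x a = begin
      toℕ x + (a + (n ∸ toℕ x))   ≡⟨ cong (toℕ x +_) (+-comm a _) ⟩
      toℕ x + ((n ∸ toℕ x) + a)   ≡⟨ +-assoc (toℕ x) _ a ⟨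
      toℕ x + (n ∸ toℕ x) + a     ≡⟨ cong (_+ a) (m+[n∸m]≡n (<⇒≤ (toℕ<n x))) ⟩
      n + a                       ≡⟨ +-comm n a ⟩
      a + n                       ∎

  ⊕-⊖ : ∀ x y → x ⊕ (y ⊖ x) ≡ y
  ⊕-⊖ x y = toℕ-injective (begin
    toℕ (x ⊕ (y ⊖ x))                        ≡⟨ cong toℕ (⊕-% x (toℕ y + (n ∸ toℕ x))) ⟩
    toℕ (x ⊕ (toℕ y + (n ∸ toℕ x)))          ≡⟨ toℕ-⊕ x _ ⟩
    (toℕ x + (toℕ y + (n ∸ toℕ x))) % n      ≡⟨ cong (_% n) (x+[a+[n∸x]]≡a+n x (toℕ y)) ⟩
    (toℕ y + n) % n                          ≡⟨ [m+n]%n≡m%n (toℕ y) n ⟩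
    toℕ y % n                                ≡⟨ %-fin y ⟩
    toℕ y                                    ∎)

  ⊕-⊖-cancel : ∀ x a → (x ⊕ a) ⊖ x ≡ a % n
  ⊕-⊖-cancel x a = begin
    (toℕ (x ⊕ a) + (n ∸ toℕ x)) % n          ≡⟨ cong (λ v → (v + (n ∸ toℕ x)) % n) (toℕ-⊕ x a) ⟩
    ((toℕ x + a) % n + (n ∸ toℕ x)) % n      ≡⟨ %-absorbˡ (toℕ x + a) _ ⟩
    (toℕ x + a + (n ∸ toℕ x)) % n            ≡⟨ cong (_% n) (+-assoc (toℕ x) a _) ⟩
    (toℕ x + (a + (n ∸ toℕ x))) % n          ≡⟨ cong (_% n) (x+[a+[n∸x]]≡a+n x a) ⟩
    (a + n) % n                              ≡⟨ [m+n]%n≡m%n a n ⟩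
    a % n                                    ∎

  ⊕-cancelˡ : ∀ x {a b} → a < n → b < n → x ⊕ a ≡ x ⊕ b → a ≡ b
  ⊕-cancelˡ x {a} {b} a<n b<n eq = begin
    a            ≡⟨ m<n⇒m%n≡m a<n ⟨
    a % n        ≡⟨ ⊕-⊖-cancel x a ⟨
    (x ⊕ a) ⊖ x  ≡⟨ cong (_⊖ x) eq ⟩
    (x ⊕ b) ⊖ x  ≡⟨ ⊕-⊖-cancel x b ⟩
    b % n        ≡⟨ m<n⇒m%n≡m b<n ⟩
    b            ∎

  ⊕-fixed⇒∣ : ∀ x a → x ⊕ a ≡ x → n ∣ a
  ⊕-fixed⇒∣ x a fixed = m%n≡0⇒n∣m a n (⊕-cancelˡ x (m%n<n a n) n>0 (begin
    x ⊕ a % n    ≡⟨ ⊕-% x a ⟩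
    x ⊕ a        ≡⟨ fixed ⟩
    x            ≡⟨ ⊕-identityʳ x ⟨
    x ⊕ 0        ∎))
    where
      n>0 : 0 < n
      n>0 = >-nonZero⁻¹ n

  private
    a+a*pred[n]≡a*n : ∀ a → a + a * pred n ≡ a * n
    a+a*pred[n]≡a*n a = begin
      a + a * pred n     ≡⟨ *-suc a (pred n) ⟨
      a * suc (pred n)   ≡⟨ cong (a *_) (suc-pred n) ⟩
      a * n              ∎

  ⊕-⊕-negate : ∀ x a → x ⊕ a ⊕ a * pred n ≡ x
  ⊕-⊕-negate x a = begin
    x ⊕ a ⊕ a * pred n      ≡⟨ ⊕-⊕ x a (a * pred n) ⟩
    x ⊕ (a + a * pred n)    ≡⟨ cong (x ⊕_) (a+a*pred[n]≡a*n a) ⟩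
    x ⊕ a * n               ≡⟨ ⊕-multiple x a ⟩
    x                       ∎

  ⊕-negate-⊕ : ∀ x a → x ⊕ a * pred n ⊕ a ≡ x
  ⊕-negate-⊕ x a = begin
    x ⊕ a * pred n ⊕ a      ≡⟨ ⊕-⊕ x (a * pred n) a ⟩
    x ⊕ (a * pred n + a)    ≡⟨ cong (x ⊕_) (+-comm (a * pred n) a) ⟩
    x ⊕ (a + a * pred n)    ≡⟨ cong (x ⊕_) (a+a*pred[n]≡a*n a) ⟩
    x ⊕ a * n               ≡⟨ ⊕-multiple x a ⟩
    x                       ∎

-- Voltage lifts of the directed n-cycle

walkSum : ∀ {n} .{{_ : NonZero n}} → (Fin n → ℕ) → ℕ → Fin n → ℕ
walkSum c zero    p = 0
walkSum c (suc k) p = c p + walkSum c k (p ⊕ 1)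

module _ {n : ℕ} .{{_ : NonZero n}} (c : Fin n → ℕ) where

  walkSum-+ : ∀ a b p → walkSum c (a + b) p ≡ walkSum c a p + walkSum c b (p ⊕ a)
  walkSum-+ zero    b p = cong (walkSum c b) (sym (⊕-identityʳ p))
  walkSum-+ (suc a) b p = begin
    c p + walkSum c (a + b) (p ⊕ 1)                              ≡⟨ cong (c p +_) (walkSum-+ a b (p ⊕ 1)) ⟩
    c p + (walkSum c a (p ⊕ 1) + walkSum c b (p ⊕ 1 ⊕ a))        ≡⟨ +-assoc (c p) _ _ ⟨
    c p + walkSum c a (p ⊕ 1) + walkSum c b (p ⊕ 1 ⊕ a)          ≡⟨ cong (_ +_) (cong (walkSum c b) (⊕-⊕ p 1 a)) ⟩
    c p + walkSum c a (p ⊕ 1) + walkSum c b (p ⊕ suc a)          ∎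

  walkSum-turns : ∀ j p → walkSum c (j * n) p ≡ j * walkSum c n p
  walkSum-turns zero    p = refl
  walkSum-turns (suc j) p = begin
    walkSum c (n + j * n) p                          ≡⟨ walkSum-+ n (j * n) p ⟩
    walkSum c n p + walkSum c (j * n) (p ⊕ n)        ≡⟨ cong (_ +_) (cong (walkSum c (j * n)) (⊕-modulus p)) ⟩
    walkSum c n p + walkSum c (j * n) p              ≡⟨ cong (walkSum c n p +_) (walkSum-turns j p) ⟩
    walkSum c n p + j * walkSum c n p                ∎

  walkSum-rotate : ∀ p → walkSum c n (p ⊕ 1) ≡ walkSum c n p
  walkSum-rotate p = +-cancelˡ-≡ (c p) _ _ (begin
    walkSum c (1 + n) p                        ≡⟨ cong (λ k → walkSum c k p) (+-comm 1 n) ⟩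
    walkSum c (n + 1) p                        ≡⟨ walkSum-+ n 1 p ⟩
    walkSum c n p + (c (p ⊕ n) + 0)            ≡⟨ cong (λ q → walkSum c n p + (c q + 0)) (⊕-modulus p) ⟩
    walkSum c n p + (c p + 0)                  ≡⟨ cong (walkSum c n p +_) (+-identityʳ (c p)) ⟩
    walkSum c n p + c p                        ≡⟨ +-comm _ (c p) ⟩
    c p + walkSum c n p                        ∎)

  walkSum-any-start : ∀ p q → walkSum c n p ≡ walkSum c n q
  walkSum-any-start p q = trans (cong (walkSum c n) (sym (⊕-⊖ q p))) (after (p ⊖ q))
    where
      after : ∀ j → walkSum c n (q ⊕ j) ≡ walkSum c n q
      after zero    = cong (walkSum c n) (⊕-identityʳ q)
      after (suc j) = begin
        walkSum c n (q ⊕ suc j)         ≡⟨ cong (λ k → walkSum c n (q ⊕ k)) (+-comm 1 j) ⟩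
        walkSum c n (q ⊕ (j + 1))       ≡⟨ cong (walkSum c n) (⊕-⊕ q j 1) ⟨
        walkSum c n (q ⊕ j ⊕ 1)         ≡⟨ walkSum-rotate (q ⊕ j) ⟩
        walkSum c n (q ⊕ j)             ≡⟨ after j ⟩
        walkSum c n q                   ∎

module VoltageLift {n m : ℕ} .{{_ : NonZero n}} .{{_ : NonZero m}} (c : Fin n → ℕ) where

  step : Fin n × Fin m → Fin n × Fin m
  step (p , x) = p ⊕ 1 , x ⊕ c p

  unstep : Fin n × Fin m → Fin n × Fin m
  unstep (p , x) = p ⊕ 1 * pred n , x ⊕ c (p ⊕ 1 * pred n) * pred m

  unstep-step : ∀ v → unstep (step v) ≡ v
  unstep-step (p , x) = cong₂ _,_ back (trans (cong (λ q → x ⊕ c p ⊕ c q * pred m) back) (⊕-⊕-negate x (c p)))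
    where
      back : p ⊕ 1 ⊕ 1 * pred n ≡ p
      back = ⊕-⊕-negate p 1

  step-unstep : ∀ v → step (unstep v) ≡ v
  step-unstep (p , x) = cong₂ _,_ (⊕-negate-⊕ p 1) (⊕-negate-⊕ x (c (p ⊕ 1 * pred n)))

  iter-step : ∀ k p x → iter k step (p , x) ≡ (p ⊕ k , x ⊕ walkSum c k p)
  iter-step zero    p x = sym (cong₂ _,_ (⊕-identityʳ p) (⊕-identityʳ x))
  iter-step (suc k) p x = begin
    iter (suc k) step (p , x)                        ≡⟨ iter-suc step k (p , x) ⟩
    iter k step (p ⊕ 1 , x ⊕ c p)                    ≡⟨ iter-step k (p ⊕ 1) (x ⊕ c p) ⟩
    (p ⊕ 1 ⊕ k , x ⊕ c p ⊕ walkSum c k (p ⊕ 1))      ≡⟨ cong₂ _,_ (⊕-⊕ p 1 k) (⊕-⊕ x (c p) _) ⟩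
    (p ⊕ suc k , x ⊕ walkSum c (suc k) p)            ∎

  factor : 1 < n → ∀ {d g q} (p₀ : Fin n) → d * g ≡ m → walkSum c n p₀ ≡ g + q * m →
           CtFactor (K* n m) (d * n)
  factor 1<n {d} {g} {q} p₀ dg≡m total = record
    { succ      = step
    ; bijective = unstep , unstep-step , step-unstep
    ; arcs      = λ (p , x) p≡p⊕1 → <⇒≱ 1<n (∣⇒≤ (⊕-fixed⇒∣ p 1 (sym p≡p⊕1)))
    ; closes    = closes
    ; exact     = exact
    }
    where
      j*[g+q*m] : ∀ j → j * (g + q * m) ≡ j * g + (j * q) * m
      j*[g+q*m] j = trans (*-distribˡ-+ j g (q * m)) (cong (j * g +_) (sym (*-assoc j q m)))

      x⊕turns : ∀ j p x → x ⊕ walkSum c (j * n) p ≡ x ⊕ j * g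
      x⊕turns j p x = begin
        x ⊕ walkSum c (j * n) p          ≡⟨ cong (x ⊕_) (walkSum-turns c j p) ⟩
        x ⊕ j * walkSum c n p            ≡⟨ cong (λ w → x ⊕ j * w) (trans (walkSum-any-start c p p₀) total) ⟩
        x ⊕ j * (g + q * m)              ≡⟨ cong (x ⊕_) (j*[g+q*m] j) ⟩
        x ⊕ (j * g + (j * q) * m)        ≡⟨ ⊕-+-multiple x (j * g) (j * q) ⟩
        x ⊕ j * g                        ∎

      closes : ∀ v → iter (d * n) step v ≡ v
      closes (p , x) = trans (iter-step (d * n) p x) (cong₂ _,_ (⊕-multiple p d) (begin
        x ⊕ walkSum c (d * n) p          ≡⟨ x⊕turns d p x ⟩
        x ⊕ d * g                        ≡⟨ cong (x ⊕_) (trans dg≡m (sym (*-identityˡ m))) ⟩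
        x ⊕ 1 * m                        ≡⟨ ⊕-multiple x 1 ⟩
        x                                ∎))

      g≢0 : g ≢ 0
      g≢0 refl = ≢-nonZero⁻¹ m (trans (sym dg≡m) (*-zeroʳ d))

      no-shorter-turn : ∀ j x → suc j < d → x ⊕ suc j * g ≢ x
      no-shorter-turn j x j<d x⊕jg≡x
        with m*n≡0⇒m≡0 (suc j) g {{≢-nonZero g≢0}}
               (⊕-cancelˡ x jg<m (>-nonZero⁻¹ m) (trans x⊕jg≡x (sym (⊕-identityʳ x))))
        where
          jg<m : suc j * g < m
          jg<m = subst (suc j * g <_) dg≡m (*-monoˡ-< g {{≢-nonZero g≢0}} j<d)
      ... | ()

      shorter-turn : ∀ p x k → 0 < k → k < d * n → n ∣ k → x ⊕ walkSum c k p ≢ x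
      shorter-turn p x .(0 * n)     () k<dn (divides zero    refl)
      shorter-turn p x .(suc j * n) _  k<dn (divides (suc j) refl) shifted =
        no-shorter-turn j x (*-cancelʳ-< n (suc j) d k<dn) (trans (sym (x⊕turns (suc j) p x)) shifted)

      exact : ∀ v k → 0 < k → k < d * n → iter k step v ≢ v
      exact (p , x) k 0<k k<dn closed =
        shorter-turn p x k 0<k k<dn (⊕-fixed⇒∣ p k (cong proj₁ moved)) (cong proj₂ moved)
        where
          moved : (p ⊕ k , x ⊕ walkSum c k p) ≡ (p , x)
          moved = trans (sym (iter-step k p x)) closed

module Shifts (k : ℕ) where

  m : ℕ
  m = 3 + (k + k)

  data Shift : Set where
    none    : Shift
    up down : Fin (suc k) → Shift

  value : Shift → ℕ
  value none     = 0
  value (up a)   = suc (toℕ a)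
  value (down a) = m ∸ suc (toℕ a)

  private
    1+k<m : suc k < m
    1+k<m = s≤s (s≤s (m≤n⇒m≤1+n (m≤m+n k k)))

    1+a<m : ∀ (a : Fin (suc k)) → suc (toℕ a) < m
    1+a<m a = ≤-<-trans (toℕ<n a) 1+k<m

    up≢down : ∀ a b → value (up a) ≢ value (down b)
    up≢down a b eq = <-irrefl sums-to-m (≤-<-trans (+-mono-≤ (toℕ<n a) (toℕ<n b)) 2+2k<m)
      where
        2+2k<m : suc k + suc k < m
        2+2k<m = s≤s (s≤s (≤-reflexive (+-suc k k)))
        sums-to-m : suc (toℕ a) + suc (toℕ b) ≡ m
        sums-to-m = trans (cong (_+ suc (toℕ b)) eq) (m∸n+n≡m (<⇒≤ (1+a<m b)))

  value<m : ∀ s → value s < m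
  value<m none     = s≤s z≤n
  value<m (up a)   = 1+a<m a
  value<m (down a) = ∸-monoʳ-< {m} z<s (<⇒≤ (1+a<m a))

  value-up+down : ∀ a → value (up a) + value (down a) ≡ m
  value-up+down a = m+[n∸m]≡n (<⇒≤ (1+a<m a))

  value-injective : ∀ s s′ → value s ≡ value s′ → s ≡ s′
  value-injective none     none      _  = refl
  value-injective none     (down b)  eq = ⊥-elim (m>n⇒m∸n≢0 (1+a<m b) (sym eq))
  value-injective (down a) none      eq = ⊥-elim (m>n⇒m∸n≢0 (1+a<m a) eq)
  value-injective (up a)   (up b)    eq = cong up (toℕ-injective (suc-injective eq))
  value-injective (down a) (down b)  eq =
    cong down (toℕ-injective (suc-injective (∸-cancelˡ-≡ (<⇒≤ (1+a<m a)) (<⇒≤ (1+a<m b)) eq)))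
  value-injective (up a)   (down b)  eq = ⊥-elim (up≢down a b eq)
  value-injective (down a) (up b)    eq = ⊥-elim (up≢down b a (sym eq))
  value-injective none     (up _)    ()
  value-injective (up _)   none      ()

  classify : ∀ z → z < m → Σ Shift λ s → value s ≡ z
  classify zero    _     = none , refl
  classify (suc z) 1+z<m with z ≤? k
  ... | yes z≤k = up (fromℕ< (s≤s z≤k)) , cong suc (toℕ-fromℕ< (s≤s z≤k))
  ... | no  z≰k = down (fromℕ< r<1+k) , (begin
        m ∸ suc (toℕ (fromℕ< r<1+k))  ≡⟨ cong (λ v → m ∸ suc v) (toℕ-fromℕ< r<1+k) ⟩
        m ∸ suc r                      ≡⟨ pred[m∸n]≡m∸[1+n] m r ⟨
        pred (m ∸ r)                   ≡⟨ cong pred (m∸[m∸n]≡n 1+z<m) ⟩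
        suc z                          ∎)
    where
      r : ℕ
      r = m ∸ suc (suc z)
      r<1+k : r < suc k
      r<1+k = s≤s (≤-trans (∸-monoʳ-≤ m (s≤s (s≤s (≰⇒> z≰k)))) (≤-reflexive (m+n∸m≡n k k)))

-- Patterns and their finite checks

data Sign : Set where
  plus minus neutral : Sign

_≟ˢ_ : DecidableEquality Sign
plus    ≟ˢ plus    = yes refl
minus   ≟ˢ minus   = yes refl
neutral ≟ˢ neutral = yes refl
plus    ≟ˢ minus   = no λ ()
plus    ≟ˢ neutral = no λ ()
minus   ≟ˢ plus    = no λ ()
minus   ≟ˢ neutral = no λ ()
neutral ≟ˢ plus    = no λ ()
neutral ≟ˢ minus   = no λ ()

#plus #minus : ∀ {l} → Vec Sign l → ℕ
#plus  = count (_≟ˢ plus)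
#minus = count (_≟ˢ minus)

sum-weights : ∀ (w : Sign → ℕ) → w neutral ≡ 0 → ∀ {l} (r : Vec Sign l) →
  sum (map w r) ≡ #plus r * w plus + #minus r * w minus
sum-weights w w0 []            = refl
sum-weights w w0 (plus ∷ r)    =
  trans (cong (w plus +_) (sum-weights w w0 r)) (sym (+-assoc (w plus) _ _))
sum-weights w w0 (minus ∷ r)   =
  trans (cong (w minus +_) (sum-weights w w0 r)) (x∙yz≈y∙xz (w minus) (#plus r * w plus) _)
sum-weights w w0 (neutral ∷ r) = trans (cong (_+ sum (map w r)) w0) (sum-weights w w0 r)

preimage : ∀ {l} → (Fin (suc l) → Fin (suc l)) → Fin (suc l) → Fin (suc l)
preimage f i with any? (λ p → f p ≟ᶠ i)
... | yes (p , _) = p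
... | no  _       = zero

record Pattern : Set where
  constructor _∥_
  field
    cycle : Vec (Fin 6) 6
    signs : Vec Sign 6

  part : Fin 6 → Fin 6
  part = lookup cycle

  position : Fin 6 → Fin 6
  position = preimage part

  next : Fin 6 → Fin 6
  next i = part (position i ⊕ 1)

  signAt : Fin 6 → Sign
  signAt i = lookup signs (position i)

record WellFormed (π : Pattern) : Set where
  open Pattern π
  field
    position-part : ∀ p → position (part p) ≡ p
    part-position : ∀ i → part (position i) ≡ i
    starts-at-0   : part zero ≡ zero
    balanced      : #plus signs ≡ #minus signs

wellFormed? : ∀ π → Dec (WellFormed π)
wellFormed? π = map′
  (λ (pp , pp′ , s0 , bal) → record
    { position-part = pp ; part-position = pp′ ; starts-at-0 = s0 ; balanced = bal })
  (λ w → let open WellFormed w in position-part , part-position , starts-at-0 , balanced)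
  ( (all? λ p → position (part p) ≟ᶠ p)
  ×-dec (all? λ i → part (position i) ≟ᶠ i)
  ×-dec (part zero ≟ᶠ zero)
  ×-dec (#plus signs ≟ #minus signs))
  where open Pattern π

module _ {size : ℕ} (ps : Vec Pattern size) where
  open Pattern

  Realizes : Sign → Set
  Realizes s = ∀ i j → i ≡ j ⊎ Σ (Fin size) λ b → next (lookup ps b) i ≡ j × signAt (lookup ps b) i ≡ s

  realizes? : ∀ s → Dec (Realizes s)
  realizes? s = all? λ i → all? λ j →
    (i ≟ᶠ j) ⊎-dec any? λ b → (next (lookup ps b) i ≟ᶠ j) ×-dec (signAt (lookup ps b) i ≟ˢ s)

  RealizedAtMostOnce : Set
  RealizedAtMostOnce = ∀ b b′ i → next (lookup ps b) i ≡ next (lookup ps b′) i →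
    signAt (lookup ps b) i ≡ signAt (lookup ps b′) i → b ≡ b′

  realizer : ∀ {s} → Realizes s → ∀ i j → i ≢ j →
    Σ (Fin size) λ b → next (lookup ps b) i ≡ j × signAt (lookup ps b) i ≡ s
  realizer r i j i≢j with r i j
  ... | inj₁ i≡j = ⊥-elim (i≢j i≡j)
  ... | inj₂ found = found

  realizer-unique : RealizedAtMostOnce → ∀ {s} (r : Realizes s) b i (i≢j : i ≢ next (lookup ps b) i) →
    signAt (lookup ps b) i ≡ s → proj₁ (realizer r i (next (lookup ps b) i) i≢j) ≡ b
  realizer-unique once r b i i≢j signed =
    let (b′ , next≡ , sign≡) = realizer r i _ i≢j in once b′ b i next≡ (trans sign≡ (sym signed))

  realizedAtMostOnce? : Dec RealizedAtMostOnce
  realizedAtMostOnce? = all? λ b → all? λ b′ → all? λ i →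
    (next (lookup ps b) i ≟ᶠ next (lookup ps b′) i) →-dec
    (signAt (lookup ps b) i ≟ˢ signAt (lookup ps b′) i) →-dec (b ≟ᶠ b′)

largePatterns : Vec Pattern 10
largePatterns =
  (# 0 ∷ # 1 ∷ # 2 ∷ # 4 ∷ # 5 ∷ # 3 ∷ []) ∥ (minus ∷ minus ∷ minus ∷ plus ∷ plus ∷ plus ∷ []) ∷
  (# 0 ∷ # 1 ∷ # 2 ∷ # 4 ∷ # 5 ∷ # 3 ∷ []) ∥ (plus ∷ plus ∷ plus ∷ minus ∷ minus ∷ minus ∷ []) ∷
  (# 0 ∷ # 2 ∷ # 1 ∷ # 3 ∷ # 5 ∷ # 4 ∷ []) ∥ (minus ∷ minus ∷ minus ∷ plus ∷ plus ∷ plus ∷ []) ∷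
  (# 0 ∷ # 2 ∷ # 1 ∷ # 3 ∷ # 5 ∷ # 4 ∷ []) ∥ (plus ∷ plus ∷ plus ∷ minus ∷ minus ∷ minus ∷ []) ∷
  (# 0 ∷ # 3 ∷ # 1 ∷ # 4 ∷ # 2 ∷ # 5 ∷ []) ∥ (minus ∷ minus ∷ minus ∷ plus ∷ plus ∷ plus ∷ []) ∷
  (# 0 ∷ # 3 ∷ # 4 ∷ # 1 ∷ # 5 ∷ # 2 ∷ []) ∥ (plus ∷ minus ∷ minus ∷ minus ∷ plus ∷ plus ∷ []) ∷
  (# 0 ∷ # 4 ∷ # 2 ∷ # 3 ∷ # 1 ∷ # 5 ∷ []) ∥ (minus ∷ minus ∷ plus ∷ plus ∷ plus ∷ minus ∷ []) ∷
  (# 0 ∷ # 4 ∷ # 3 ∷ # 2 ∷ # 5 ∷ # 1 ∷ []) ∥ (plus ∷ plus ∷ minus ∷ minus ∷ plus ∷ minus ∷ []) ∷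
  (# 0 ∷ # 5 ∷ # 2 ∷ # 3 ∷ # 4 ∷ # 1 ∷ []) ∥ (minus ∷ minus ∷ minus ∷ plus ∷ plus ∷ plus ∷ []) ∷
  (# 0 ∷ # 5 ∷ # 1 ∷ # 4 ∷ # 3 ∷ # 2 ∷ []) ∥ (plus ∷ minus ∷ plus ∷ minus ∷ plus ∷ minus ∷ []) ∷
  []

smallPatterns : Vec Pattern 15
smallPatterns =
  (# 0 ∷ # 1 ∷ # 3 ∷ # 5 ∷ # 2 ∷ # 4 ∷ []) ∥ (minus ∷ minus ∷ plus ∷ plus ∷ minus ∷ plus ∷ []) ∷
  (# 0 ∷ # 1 ∷ # 3 ∷ # 5 ∷ # 2 ∷ # 4 ∷ []) ∥ (neutral ∷ neutral ∷ neutral ∷ neutral ∷ neutral ∷ neutral ∷ []) ∷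
  (# 0 ∷ # 1 ∷ # 3 ∷ # 5 ∷ # 2 ∷ # 4 ∷ []) ∥ (plus ∷ plus ∷ minus ∷ minus ∷ plus ∷ minus ∷ []) ∷
  (# 0 ∷ # 2 ∷ # 5 ∷ # 1 ∷ # 4 ∷ # 3 ∷ []) ∥ (minus ∷ plus ∷ minus ∷ minus ∷ plus ∷ plus ∷ []) ∷
  (# 0 ∷ # 2 ∷ # 5 ∷ # 1 ∷ # 4 ∷ # 3 ∷ []) ∥ (neutral ∷ neutral ∷ neutral ∷ neutral ∷ neutral ∷ neutral ∷ []) ∷
  (# 0 ∷ # 2 ∷ # 5 ∷ # 4 ∷ # 3 ∷ # 1 ∷ []) ∥ (plus ∷ minus ∷ plus ∷ minus ∷ plus ∷ minus ∷ []) ∷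
  (# 0 ∷ # 3 ∷ # 4 ∷ # 5 ∷ # 1 ∷ # 2 ∷ []) ∥ (minus ∷ plus ∷ plus ∷ plus ∷ minus ∷ minus ∷ []) ∷
  (# 0 ∷ # 3 ∷ # 4 ∷ # 2 ∷ # 1 ∷ # 5 ∷ []) ∥ (neutral ∷ neutral ∷ plus ∷ minus ∷ minus ∷ plus ∷ []) ∷
  (# 0 ∷ # 3 ∷ # 2 ∷ # 1 ∷ # 4 ∷ # 5 ∷ []) ∥ (plus ∷ minus ∷ neutral ∷ plus ∷ neutral ∷ minus ∷ []) ∷
  (# 0 ∷ # 4 ∷ # 1 ∷ # 5 ∷ # 3 ∷ # 2 ∷ []) ∥ (minus ∷ neutral ∷ neutral ∷ plus ∷ neutral ∷ neutral ∷ []) ∷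
  (# 0 ∷ # 4 ∷ # 5 ∷ # 3 ∷ # 2 ∷ # 1 ∷ []) ∥ (neutral ∷ minus ∷ minus ∷ plus ∷ plus ∷ neutral ∷ []) ∷
  (# 0 ∷ # 4 ∷ # 2 ∷ # 3 ∷ # 1 ∷ # 5 ∷ []) ∥ (plus ∷ minus ∷ minus ∷ neutral ∷ plus ∷ neutral ∷ []) ∷
  (# 0 ∷ # 5 ∷ # 4 ∷ # 1 ∷ # 2 ∷ # 3 ∷ []) ∥ (minus ∷ neutral ∷ plus ∷ neutral ∷ plus ∷ minus ∷ []) ∷
  (# 0 ∷ # 5 ∷ # 3 ∷ # 4 ∷ # 1 ∷ # 2 ∷ []) ∥ (neutral ∷ neutral ∷ minus ∷ minus ∷ plus ∷ plus ∷ []) ∷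
  (# 0 ∷ # 5 ∷ # 4 ∷ # 2 ∷ # 3 ∷ # 1 ∷ []) ∥ (plus ∷ minus ∷ neutral ∷ neutral ∷ minus ∷ plus ∷ []) ∷
  []

-- Abstract: unfolding these checked searches makes type checking the construction intractable.
abstract
  large-wellFormed : ∀ b → WellFormed (lookup largePatterns b)
  large-wellFormed = toWitness {a? = all? (wellFormed? ∘ lookup largePatterns)} _

  small-wellFormed : ∀ b → WellFormed (lookup smallPatterns b)
  small-wellFormed = toWitness {a? = all? (wellFormed? ∘ lookup smallPatterns)} _

  large-once : RealizedAtMostOnce largePatterns
  large-once = toWitness {a? = realizedAtMostOnce? largePatterns} _

  small-once : RealizedAtMostOnce smallPatterns
  small-once = toWitness {a? = realizedAtMostOnce? smallPatterns} _

  large-realizes-plus : Realizes largePatterns plus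
  large-realizes-plus = toWitness {a? = realizes? largePatterns plus} _

  large-realizes-minus : Realizes largePatterns minus
  large-realizes-minus = toWitness {a? = realizes? largePatterns minus} _

  large-not-neutral : ∀ b i → Pattern.signAt (lookup largePatterns b) i ≢ neutral
  large-not-neutral =
    toWitness {a? = all? λ b → all? λ i → ¬? (Pattern.signAt (lookup largePatterns b) i ≟ˢ neutral)} _

  small-realizes : ∀ s → Realizes smallPatterns s
  small-realizes plus    = toWitness {a? = realizes? smallPatterns plus} _
  small-realizes minus   = toWitness {a? = realizes? smallPatterns minus} _
  small-realizes neutral = toWitness {a? = realizes? smallPatterns neutral} _

module Construction (k : ℕ) {d g : ℕ} (d*g≡m : d * g ≡ Shifts.m k) where
  open Shifts k
  open Pattern using (signs; part; position; next; signAt)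

  Index : Set
  Index = Fin 15 ⊎ (Fin 10 × Fin k)

  patternOf : Index → Pattern
  patternOf (inj₁ b)       = lookup smallPatterns b
  patternOf (inj₂ (b , _)) = lookup largePatterns b

  wellFormed : ∀ e → WellFormed (patternOf e)
  wellFormed (inj₁ b)       = small-wellFormed b
  wellFormed (inj₂ (b , _)) = large-wellFormed b

  amplitude : Index → Fin (suc k)
  amplitude (inj₁ _)       = zero
  amplitude (inj₂ (_ , a)) = suc a

  shiftOf : Sign → Fin (suc k) → Shift
  shiftOf plus    = up
  shiftOf minus   = down
  shiftOf neutral = λ _ → none

  base : Fin 6 → ℕ
  base zero    = g
  base (suc _) = 0

  voltage : Index → Fin 6 → ℕ
  voltage e p = base p + value (shiftOf (lookup (signs (patternOf e)) p) (amplitude e))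

  walkSum-base : ∀ (w : Sign → ℕ) (r : Vec Sign 6) →
    walkSum (λ p → base p + w (lookup r p)) 6 zero ≡ g + sum (map w r)
  walkSum-base w (s₀ ∷ s₁ ∷ s₂ ∷ s₃ ∷ s₄ ∷ s₅ ∷ []) = +-assoc g (w s₀) _

  voltage-total : ∀ e → walkSum (voltage e) 6 zero ≡ g + #plus (signs (patternOf e)) * m
  voltage-total e = begin
    walkSum (voltage e) 6 zero                     ≡⟨ walkSum-base w r ⟩
    g + sum (map w r)                              ≡⟨ cong (g +_) (sum-weights w refl r) ⟩
    g + (#plus r * w plus + #minus r * w minus)    ≡⟨ cong (λ c → g + (#plus r * w plus + c * w minus)) balanced ⟨
    g + (#plus r * w plus + #plus r * w minus)     ≡⟨ cong (g +_) (*-distribˡ-+ (#plus r) (w plus) (w minus)) ⟨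
    g + #plus r * (w plus + w minus)               ≡⟨ cong (λ v → g + #plus r * v) (value-up+down (amplitude e)) ⟩
    g + #plus r * m                                ∎
    where
      open WellFormed (wellFormed e) using (balanced)
      r : Vec Sign 6
      r = signs (patternOf e)
      w : Sign → ℕ
      w s = value (shiftOf s (amplitude e))

  factor : Index → CtFactor (K* 6 m) (d * 6)
  factor e = permuteParts (part (patternOf e)) (position (patternOf e)) position-part part-position
    (VoltageLift.factor (voltage e) (s≤s (s≤s z≤n)) {d = d} {q = #plus (signs (patternOf e))} zero d*g≡m
      (voltage-total e))
    where open WellFormed (wellFormed e)

  nextAt : Index → Fin 6 → Fin 6
  nextAt e = next (patternOf e)

  shiftAt : Index → Fin 6 → Shift
  shiftAt e i = shiftOf (signAt (patternOf e) i) (amplitude e)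

  position≡0⇒≡0 : ∀ e {i} → position (patternOf e) i ≡ zero → i ≡ zero
  position≡0⇒≡0 e {i} eq =
    trans (sym (part-position i)) (trans (cong (part (patternOf e)) eq) starts-at-0)
    where open WellFormed (wellFormed e)

  base-position : ∀ e i → base (position (patternOf e) i) ≡ base i
  base-position e zero =
    cong base (trans (cong (position (patternOf e)) (sym starts-at-0)) (position-part zero))
    where open WellFormed (wellFormed e)
  base-position e (suc i) with position (patternOf e) (suc i) in eq
  ... | suc _ = refl
  ... | zero with () ← position≡0⇒≡0 e eq

  succ-factor : ∀ e i x → CtFactor.succ (factor e) (i , x) ≡ (nextAt e i , x ⊕ base i ⊕ value (shiftAt e i))
  succ-factor e i x = cong (nextAt e i ,_) (begin
    x ⊕ (base (position (patternOf e) i) + v)   ≡⟨ cong (λ b → x ⊕ (b + v)) (base-position e i) ⟩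
    x ⊕ (base i + v)                            ≡⟨ ⊕-⊕ x (base i) v ⟨
    x ⊕ base i ⊕ v                              ∎)
    where
      v : ℕ
      v = value (shiftAt e i)

  decode : ∀ i j → i ≢ j → Shift → Index
  decode i j i≢j none         = inj₁ (proj₁ (realizer smallPatterns (small-realizes neutral) i j i≢j))
  decode i j i≢j (up zero)    = inj₁ (proj₁ (realizer smallPatterns (small-realizes plus) i j i≢j))
  decode i j i≢j (down zero)  = inj₁ (proj₁ (realizer smallPatterns (small-realizes minus) i j i≢j))
  decode i j i≢j (up (suc a))   = inj₂ (proj₁ (realizer largePatterns large-realizes-plus i j i≢j) , a)
  decode i j i≢j (down (suc a)) = inj₂ (proj₁ (realizer largePatterns large-realizes-minus i j i≢j) , a)

  realized : ∀ {size} (ps : Vec Pattern size) {i j s} a →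
    (found : Σ (Fin size) λ b → next (lookup ps b) i ≡ j × signAt (lookup ps b) i ≡ s) →
    next (lookup ps (proj₁ found)) i ≡ j × shiftOf (signAt (lookup ps (proj₁ found)) i) a ≡ shiftOf s a
  realized _ a (_ , next≡ , sign≡) = next≡ , cong (λ σ → shiftOf σ a) sign≡

  decode-correct : ∀ i j (i≢j : i ≢ j) s → nextAt (decode i j i≢j s) i ≡ j × shiftAt (decode i j i≢j s) i ≡ s
  decode-correct i j i≢j none =
    realized smallPatterns zero (realizer smallPatterns (small-realizes neutral) i j i≢j)
  decode-correct i j i≢j (up zero) =
    realized smallPatterns zero (realizer smallPatterns (small-realizes plus) i j i≢j)
  decode-correct i j i≢j (down zero) =
    realized smallPatterns zero (realizer smallPatterns (small-realizes minus) i j i≢j)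
  decode-correct i j i≢j (up (suc a)) =
    realized largePatterns (suc a) (realizer largePatterns large-realizes-plus i j i≢j)
  decode-correct i j i≢j (down (suc a)) =
    realized largePatterns (suc a) (realizer largePatterns large-realizes-minus i j i≢j)

  decode-unique : ∀ e {i j} (i≢j : i ≢ j) {s} → nextAt e i ≡ j → shiftAt e i ≡ s → decode i j i≢j s ≡ e
  decode-unique (inj₁ b) {i} i≢j refl refl = by-sign (signAt (lookup smallPatterns b) i) refl
    where
      by-sign : ∀ σ → signAt (lookup smallPatterns b) i ≡ σ → decode i _ i≢j (shiftOf σ zero) ≡ inj₁ b
      by-sign plus    signed =
        cong inj₁ (realizer-unique smallPatterns small-once (small-realizes plus) b i i≢j signed)
      by-sign minus   signed =
        cong inj₁ (realizer-unique smallPatterns small-once (small-realizes minus) b i i≢j signed)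
      by-sign neutral signed =
        cong inj₁ (realizer-unique smallPatterns small-once (small-realizes neutral) b i i≢j signed)
  decode-unique (inj₂ (b , a)) {i} i≢j refl refl = by-sign (signAt (lookup largePatterns b) i) refl
    where
      by-sign : ∀ σ → signAt (lookup largePatterns b) i ≡ σ → decode i _ i≢j (shiftOf σ (suc a)) ≡ inj₂ (b , a)
      by-sign plus    signed =
        cong (λ b′ → inj₂ (b′ , a)) (realizer-unique largePatterns large-once large-realizes-plus b i i≢j signed)
      by-sign minus   signed =
        cong (λ b′ → inj₂ (b′ , a)) (realizer-unique largePatterns large-once large-realizes-minus b i i≢j signed)
      by-sign neutral signed = ⊥-elim (large-not-neutral b i signed)

  cover : ∀ u v → Digraph.Arc (K* 6 m) u v → Σ Index λ e → InFactor (factor e) u v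
  cover (i , x) (j , y) i≢j = e , (begin
    CtFactor.succ (factor e) (i , x)                 ≡⟨ succ-factor e i x ⟩
    (nextAt e i , x ⊕ base i ⊕ value (shiftAt e i))  ≡⟨ cong₂ (λ j′ s′ → j′ , x ⊕ base i ⊕ value s′) next≡ shift≡ ⟩
    (j , x ⊕ base i ⊕ value s)                       ≡⟨ cong (λ z → j , x ⊕ base i ⊕ z) value≡ ⟩
    (j , x ⊕ base i ⊕ (y ⊖ (x ⊕ base i)))            ≡⟨ cong (j ,_) (⊕-⊖ (x ⊕ base i) y) ⟩
    (j , y)                                          ∎)
    where
      s : Shift
      s = proj₁ (classify (y ⊖ (x ⊕ base i)) (⊖<n y (x ⊕ base i)))
      value≡ : value s ≡ y ⊖ (x ⊕ base i)
      value≡ = proj₂ (classify (y ⊖ (x ⊕ base i)) (⊖<n y (x ⊕ base i)))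
      e : Index
      e = decode i j i≢j s
      next≡ : nextAt e i ≡ j
      next≡ = proj₁ (decode-correct i j i≢j s)
      shift≡ : shiftAt e i ≡ s
      shift≡ = proj₂ (decode-correct i j i≢j s)

  unique : ∀ e e′ u v → InFactor (factor e) u v → InFactor (factor e′) u v → e ≡ e′
  unique e e′ (i , x) v e∋uv e′∋uv = begin
    e                                                ≡⟨ decode-unique e i≢j refl refl ⟨
    decode i (nextAt e i) i≢j (shiftAt e i)          ≡⟨ decode-unique e′ i≢j (sym next≡) (sym shift≡) ⟩
    e′                                               ∎
    where
      same-arc : (nextAt e i , x ⊕ base i ⊕ value (shiftAt e i))
               ≡ (nextAt e′ i , x ⊕ base i ⊕ value (shiftAt e′ i))
      same-arc = trans (sym (succ-factor e i x)) (trans e∋uv (trans (sym e′∋uv) (succ-factor e′ i x)))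
      i≢j : i ≢ nextAt e i
      i≢j = CtFactor.arcs (factor e) (i , x)
      next≡ : nextAt e i ≡ nextAt e′ i
      next≡ = cong proj₁ same-arc
      shift≡ : shiftAt e i ≡ shiftAt e′ i
      shift≡ = value-injective _ _
        (⊕-cancelˡ (x ⊕ base i) (value<m (shiftAt e i)) (value<m (shiftAt e′ i)) (cong proj₂ same-arc))

  Index↔ : Fin (15 + 10 * k) ↔ Index
  Index↔ = ↔-trans +↔⊎ (↔-refl ⊎-↔ *↔×)

  factorization : CtFactorization (K* 6 m) (d * 6)
  factorization = factorization-from-family Index↔ factor cover unique

odd≥3⇒≡3+2k : ∀ m → 3 ≤ m → m % 2 ≡ 1 → Σ ℕ λ k → m ≡ Shifts.m k
odd≥3⇒≡3+2k 1 (s≤s ()) _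
odd≥3⇒≡3+2k 3 _ _ = 0 , refl
odd≥3⇒≡3+2k (suc (suc (suc (suc (suc m))))) _ odd =
  let (k , eq) = odd≥3⇒≡3+2k (suc (suc (suc m))) (s≤s (s≤s (s≤s z≤n))) odd
  in suc k , trans (cong (2 +_) eq) (cong (4 +_) (sym (+-suc k k)))

-- The hypothesis 0 < t is implied by t ∣ 6 m, as m ≢ 0.
corollary8p2 : (m t : ℕ) → m ≥ 3 → m % 2 ≡ 1 → 0 < t → t ∣ 6 * m → gcd 6 t ≡ 6 →
    CtFactorization (K* 6 m) t
corollary8p2 m t m≥3 m-odd _ t∣6m gcd≡6
  with odd≥3⇒≡3+2k m m≥3 m-odd | subst (_∣ t) gcd≡6 (gcd[m,n]∣n 6 t)
... | k , refl | divides d refl with *-cancelʳ-∣ 6 (subst (d * 6 ∣_) (*-comm 6 m) t∣6m)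
...   | divides g m≡g*d = Construction.factorization k {d} {g} (trans (*-comm d g) (sym m≡g*d))
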